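{- Let $n$ be an even integer and let $Q$ be an $n\times n$ centrosymmetric permutation matrix which has a centrosymmetric cycle whose length is a multiple of four. Then $\frac12(Q+Q^t)$ is not an extreme point of $\Omega_n^{t\&h}$.
   Context: For an $n\times n$ matrix $A=[a_{ij}]$: $A^t$ is the transpose; the Hankel transpose $A^h$ has $(i,j)$ entry $a_{n+1-j,n+1-i}$; $A^{\pi}$ has $(i,j)$ entry $a_{n+1-i,n+1-j}$; $A$ is Hankel-symmetric if $A^h=A$ and centrosymmetric if $A^{\pi}=A$. $\Omega_n^{t\&h}$ is the convex polytope of all $n\times n$ doubly stochastic matrices (nonnegative, all row and column sums $1$) that are both symmetric and Hankel-symmetric. A permutation matrix $Q$ is identified with the permutation $\sigma$ with $q_{i\sigma(i)}=1$. A (permutation) cycle of $Q$ of length $k$ is a cycle $\gamma: i_1\to i_2\to\cdots\to i_k\to i_1$ of $\sigma$ (so $\sigma(i_s)=i_{s+1}$, indices mod $k$). If $Q$ is centrosymmetric, then $\gamma^{\pi}: n+1-i_1\to n+1-i_2\to\cdots\to n+1-i_k\to n+1-i_1$ is also a cycle of $\sigma$; $\gamma$ is called a centrosymmetric cycle if $\gamma^{\pi}=\gamma$ (as cycles of $\sigma$). -}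

module Defs where

open import Data.Nat as ℕ using (ℕ; zero; suc)
open import Data.Nat.DivMod using (_%_; m%n<n)
open import Data.Fin as Fin using (Fin; toℕ; fromℕ<; opposite)
open import Data.Fin.Permutation using (Permutation′; _⟨$⟩ʳ_)
open import Data.Rational using (ℚ; 0ℚ; 1ℚ; _+_; _*_; _-_; _≤_; _<_)
open import Data.Product using (Σ; _×_; _,_; ∃)
open import Relation.Binary.PropositionalEquality using (_≡_)
open import Relation.Nullary.Decidable using (⌊_⌋)
open import Data.Bool using (if_then_else_)
open import Function.Definitions using (Injective)

Mat : ℕ → Set
Mat n = Fin n → Fin n → ℚ

sumFin : ∀ {n} → (Fin n → ℚ) → ℚ
sumFin {zero}  f = 0ℚ
sumFin {suc n} f = f Fin.zero + sumFin (λ i → f (Fin.suc i))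

transpose : ∀ {n} → Mat n → Mat n
transpose A i j = A j i

-- Hankel transpose: (A^h)_{ij} = a_{n+1-j, n+1-i}
hankelT : ∀ {n} → Mat n → Mat n
hankelT A i j = A (opposite j) (opposite i)

piT : ∀ {n} → Mat n → Mat n
piT A i j = A (opposite i) (opposite j)

_≐_ : ∀ {n} → Mat n → Mat n → Set
A ≐ B = ∀ i j → A i j ≡ B i j

_⊕_ : ∀ {n} → Mat n → Mat n → Mat n
(A ⊕ B) i j = A i j + B i j

_⊙_ : ∀ {n} → ℚ → Mat n → Mat n
(c ⊙ A) i j = c * A i j

IsDoublyStochastic : ∀ {n} → Mat n → Set
IsDoublyStochastic A =
  (∀ i j → 0ℚ ≤ A i j) ×
  (∀ i → sumFin (λ j → A i j) ≡ 1ℚ) ×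
  (∀ j → sumFin (λ i → A i j) ≡ 1ℚ)

InΩth : ∀ {n} → Mat n → Set
InΩth A = IsDoublyStochastic A × (transpose A ≐ A) × (hankelT A ≐ A)

IsExtremePoint : ∀ {n} → (Mat n → Set) → Mat n → Set
IsExtremePoint {n} S A =
  S A ×
  (∀ (B C : Mat n) (t : ℚ) → S B → S C → 0ℚ < t → t < 1ℚ →
     A ≐ ((t ⊙ B) ⊕ ((1ℚ - t) ⊙ C)) → B ≐ C)

permMatrix : ∀ {n} → Permutation′ n → Mat n
permMatrix σ i j = if ⌊ (σ ⟨$⟩ʳ i) Fin.≟ j ⌋ then 1ℚ else 0ℚ

IsCentrosymmetric : ∀ {n} → Mat n → Set
IsCentrosymmetric A = piT A ≐ A

csuc : ∀ {m} → Fin (suc m) → Fin (suc m)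
csuc {m} s = fromℕ< (m%n<n (suc (toℕ s)) (suc m))

-- c : Fin k → Fin n (k = suc m) is a cycle i_1 → … → i_k → i_1 of σ
IsCycleOf : ∀ {n m} → Permutation′ n → (Fin (suc m) → Fin n) → Set
IsCycleOf σ c = Injective _≡_ _≡_ c × (∀ s → σ ⟨$⟩ʳ c s ≡ c (csuc s))

-- γ^π = γ as cycles of σ: the reflected cycle has the same support
-- (a cycle of σ is determined by its support)
IsCentrosymmetricCycle : ∀ {n m} → (Fin (suc m) → Fin n) → Set
IsCentrosymmetricCycle c = ∀ s → ∃ λ t → opposite (c s) ≡ c t

-- Number the points of the centrosymmetric cycle c₀ → c₁ → ⋯ → c_{k-1} of σ modulo k,
-- and let ρ₁ (resp. ρ₀) be σ with the direction reversed at the odd (resp. even) points.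
-- On the cycle ρ₁ is the involution pairing c_{2j} with c_{2j+1} and ρ₀ the one pairing
-- c_{2j+1} with c_{2j+2}; elsewhere both agree with σ.  For every i the multiset
-- {σ i, σ⁻¹ i} is {ρ₁ i, ρ₀⁻¹ i} and also {ρ₀ i, ρ₁⁻¹ i}, so ½(Q + Qᵗ) is the midpoint
-- of the symmetrisations of ρ₁ and ρ₀, which differ at (c₀, c₁) because k > 2.  These lie
-- in Ω^{t&h} as soon as ρ₁ and ρ₀ commute with i ↦ n+1-i.  That map sends c_a to c_{a+r}
-- for a fixed shift r with 2r ≡ 0 (mod k); as 4 ∣ k, r is even, so it preserves the
-- two parity classes.
module Submission where

open import Defs
open import Data.Nat using (ℕ; suc)
open import Data.Nat.Divisibility using (_∣_)
open import Data.Fin using (Fin)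
open import Data.Fin.Permutation using (Permutation′)
open import Data.Rational using (½)
open import Relation.Nullary using (¬_)

open import Algebra.Bundles using (CommutativeMonoid)
open import Data.Bool using (true; false; if_then_else_)
open import Data.Empty using (⊥-elim)
open import Data.Fin as Fin using (zero; suc; opposite; toℕ; fromℕ<)
open import Data.Fin.Permutation using (permutation; _⟨$⟩ʳ_; _⟨$⟩ˡ_; inverseˡ; inverseʳ)
open import Data.Fin.Properties
  using (suc-injective; opposite-involutive; toℕ-fromℕ<; toℕ-injective; toℕ<n; any?)
open import Data.Nat as ℕ using (_%_; NonZero)
open import Data.Nat.DivMod
  using (m%n<n; [m+n]%n≡m%n; m%n%n≡m%n; %-distribˡ-+; %-remove-+ʳ; m<n⇒m%n≡m; m∣n⇒o%n%m≡o%m)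
open import Data.Nat.Divisibility using (divides; ∣⇒≤; m%n≡0⇒n∣m; *-cancelˡ-∣; ∣-trans)
import Data.Nat.Properties as ℕ
open import Data.Product using (_×_; _,_; ∃-syntax; proj₁; proj₂)
open import Data.Rational using (ℚ; 0ℚ; 1ℚ; _+_; _*_; _-_; _≤_)
import Data.Rational.Properties as ℚ
open import Data.Rational.Solver using (module +-*-Solver)
open import Function.Base using (_∘_)
open import Function.Bundles using (_⇔_; Equivalence)
open import Function.Construct.Composition using (_⇔-∘_)
open import Level using (0ℓ)
open import Relation.Binary.PropositionalEquality
open import Relation.Nullary using (yes; no; does)
open import Relation.Nullary.Decidable using (⌊_⌋; _×-dec_; from-yes)
open import Relation.Unary using (Pred; Decidable)

open import Algebra.Properties.CommutativeSemigroup
  (CommutativeMonoid.commutativeSemigroup ℚ.+-0-commutativeMonoid) using (interchange)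

private variable n : ℕ

δ : Fin n → Fin n → ℚ
δ a b = if ⌊ a Fin.≟ b ⌋ then 1ℚ else 0ℚ

δ-cong : ∀ {m} {a b : Fin m} {c d : Fin n} →
         (a ≡ b → c ≡ d) → (c ≡ d → a ≡ b) → δ a b ≡ δ c d
δ-cong {a = a} {b} {c} {d} to from with a Fin.≟ b | c Fin.≟ d
... | yes _   | yes _   = refl
... | no _    | no _    = refl
... | yes a≡b | no c≢d  = ⊥-elim (c≢d (to a≡b))
... | no a≢b  | yes c≡d = ⊥-elim (a≢b (from c≡d))

δ-diag : (a : Fin n) → δ a a ≡ 1ℚ
δ-diag a with a Fin.≟ a
... | yes _   = refl
... | no a≢a  = ⊥-elim (a≢a refl)

δ-off : {a b : Fin n} → ¬ a ≡ b → δ a b ≡ 0ℚ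
δ-off {a = a} {b} a≢b with a Fin.≟ b
... | yes a≡b = ⊥-elim (a≢b a≡b)
... | no _    = refl

δ≡1⇒≡ : {a b : Fin n} → δ a b ≡ 1ℚ → a ≡ b
δ≡1⇒≡ {a = a} {b} δ≡1 with a Fin.≟ b
... | yes a≡b = a≡b
... | no _    = ⊥-elim (ℚ.1≢0 (sym δ≡1))

δ-nonneg : (a b : Fin n) → 0ℚ ≤ δ a b
δ-nonneg a b with ⌊ a Fin.≟ b ⌋
... | true  = ℚ.nonNegative⁻¹ 1ℚ
... | false = ℚ.≤-refl

opposite-injective : {a b : Fin n} → opposite a ≡ opposite b → a ≡ b
opposite-injective {a = a} {b} eq =
  trans (sym (opposite-involutive a)) (trans (cong opposite eq) (opposite-involutive b))

δ-opposite : (a b : Fin n) → δ (opposite a) (opposite b) ≡ δ a b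
δ-opposite a b = δ-cong opposite-injective (cong opposite)

sumFin-cong : {f g : Fin n → ℚ} → (∀ i → f i ≡ g i) → sumFin f ≡ sumFin g
sumFin-cong {n = ℕ.zero} f≗g = refl
sumFin-cong {n = suc n}  f≗g = cong₂ _+_ (f≗g zero) (sumFin-cong (f≗g ∘ suc))

sumFin-+ : (f g : Fin n → ℚ) → sumFin (λ i → f i + g i) ≡ sumFin f + sumFin g
sumFin-+ {n = ℕ.zero} f g = refl
sumFin-+ {n = suc n}  f g =
  trans (cong (f zero + g zero +_) (sumFin-+ (f ∘ suc) (g ∘ suc)))
        (interchange (f zero) (g zero) (sumFin (f ∘ suc)) (sumFin (g ∘ suc)))

sumFin-* : (q : ℚ) (f : Fin n → ℚ) → sumFin (λ i → q * f i) ≡ q * sumFin f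
sumFin-* {n = ℕ.zero} q f = sym (ℚ.*-zeroʳ q)
sumFin-* {n = suc n}  q f =
  trans (cong (q * f zero +_) (sumFin-* q (f ∘ suc))) (sym (ℚ.*-distribˡ-+ q (f zero) _))

sumFin-zero : sumFin {n} (λ _ → 0ℚ) ≡ 0ℚ
sumFin-zero {n = ℕ.zero} = refl
sumFin-zero {n = suc n}  = cong (0ℚ +_) (sumFin-zero {n})

sumFin-δ : (a : Fin n) → sumFin (δ a) ≡ 1ℚ
sumFin-δ {n = suc n} zero =
  cong (1ℚ +_) (trans (sumFin-cong {n = n} (λ i → δ-off {a = zero} {suc i} λ ())) (sumFin-zero {n}))
sumFin-δ {n = suc n} (suc a) =
  trans (cong (0ℚ +_) (trans (sumFin-cong δ-suc) (sumFin-δ a))) (ℚ.+-identityˡ 1ℚ)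
  where
  δ-suc : ∀ i → δ (suc a) (suc i) ≡ δ a i
  δ-suc i = δ-cong suc-injective (cong suc)

symPerm : Permutation′ n → Mat n
symPerm σ = ½ ⊙ (permMatrix σ ⊕ transpose (permMatrix σ))

symPerm-entry : (σ : Permutation′ n) (i j : Fin n) →
                symPerm σ i j ≡ ½ * (δ (σ ⟨$⟩ʳ i) j + δ (σ ⟨$⟩ˡ i) j)
symPerm-entry σ i j = cong (λ x → ½ * (δ (σ ⟨$⟩ʳ i) j + x)) (δ-cong to from)
  where
  to : σ ⟨$⟩ʳ j ≡ i → σ ⟨$⟩ˡ i ≡ j
  to σj≡i = trans (cong (σ ⟨$⟩ˡ_) (sym σj≡i)) (inverseˡ σ)
  from : σ ⟨$⟩ˡ i ≡ j → σ ⟨$⟩ʳ j ≡ i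
  from σ⁻¹i≡j = trans (cong (σ ⟨$⟩ʳ_) (sym σ⁻¹i≡j)) (inverseʳ σ)

symPerm-symmetric : (σ : Permutation′ n) → transpose (symPerm σ) ≐ symPerm σ
symPerm-symmetric σ i j = cong (½ *_) (ℚ.+-comm (δ (σ ⟨$⟩ʳ j) i) (δ (σ ⟨$⟩ʳ i) j))

symPerm-rowSum : (σ : Permutation′ n) (i : Fin n) → sumFin (symPerm σ i) ≡ 1ℚ
symPerm-rowSum σ i = begin
  sumFin (symPerm σ i)
    ≡⟨ sumFin-cong (symPerm-entry σ i) ⟩
  sumFin (λ j → ½ * (δ σi j + δ σ⁻¹i j))
    ≡⟨ sumFin-* ½ (λ j → δ σi j + δ σ⁻¹i j) ⟩
  ½ * sumFin (λ j → δ σi j + δ σ⁻¹i j)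
    ≡⟨ cong (½ *_) (sumFin-+ (δ σi) (δ σ⁻¹i)) ⟩
  ½ * (sumFin (δ σi) + sumFin (δ σ⁻¹i))
    ≡⟨ cong₂ (λ x y → ½ * (x + y)) (sumFin-δ σi) (sumFin-δ σ⁻¹i) ⟩
  1ℚ ∎
  where
  open ≡-Reasoning
  σi σ⁻¹i : Fin _
  σi   = σ ⟨$⟩ʳ i
  σ⁻¹i = σ ⟨$⟩ˡ i

CommutesWithOpposite : Permutation′ n → Set
CommutesWithOpposite σ = ∀ x → σ ⟨$⟩ʳ opposite x ≡ opposite (σ ⟨$⟩ʳ x)

centrosymmetric⇒commutesWithOpposite : (σ : Permutation′ n) →
  IsCentrosymmetric (permMatrix σ) → CommutesWithOpposite σ
centrosymmetric⇒commutesWithOpposite σ centro x =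
  δ≡1⇒≡ (trans (centro x (σ ⟨$⟩ʳ x)) (δ-diag (σ ⟨$⟩ʳ x)))

⟨$⟩ʳ-injective : (σ : Permutation′ n) {x y : Fin n} → σ ⟨$⟩ʳ x ≡ σ ⟨$⟩ʳ y → x ≡ y
⟨$⟩ʳ-injective σ eq = trans (sym (inverseˡ σ)) (trans (cong (σ ⟨$⟩ˡ_) eq) (inverseˡ σ))

inverse-commutesWithOpposite : (σ : Permutation′ n) → CommutesWithOpposite σ →
  ∀ y → σ ⟨$⟩ˡ opposite y ≡ opposite (σ ⟨$⟩ˡ y)
inverse-commutesWithOpposite σ σ-opp y = begin
  σ ⟨$⟩ˡ opposite y                     ≡⟨ cong (λ z → σ ⟨$⟩ˡ opposite z) (inverseʳ σ) ⟨
  σ ⟨$⟩ˡ opposite (σ ⟨$⟩ʳ (σ ⟨$⟩ˡ y))   ≡⟨ cong (σ ⟨$⟩ˡ_) (σ-opp (σ ⟨$⟩ˡ y)) ⟨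
  σ ⟨$⟩ˡ (σ ⟨$⟩ʳ opposite (σ ⟨$⟩ˡ y))   ≡⟨ inverseˡ σ ⟩
  opposite (σ ⟨$⟩ˡ y)                   ∎
  where open ≡-Reasoning

symPerm-hankelSymmetric : (σ : Permutation′ n) → CommutesWithOpposite σ →
  hankelT (symPerm σ) ≐ symPerm σ
symPerm-hankelSymmetric σ σ-opp i j = begin
  ½ * (δ (σ ⟨$⟩ʳ opposite j) (opposite i) + δ (σ ⟨$⟩ʳ opposite i) (opposite j))
    ≡⟨ cong₂ (λ x y → ½ * (δ x (opposite i) + δ y (opposite j))) (σ-opp j) (σ-opp i) ⟩
  ½ * (δ (opposite (σ ⟨$⟩ʳ j)) (opposite i) + δ (opposite (σ ⟨$⟩ʳ i)) (opposite j))
    ≡⟨ cong₂ (λ x y → ½ * (x + y)) (δ-opposite _ i) (δ-opposite _ j) ⟩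
  transpose (symPerm σ) i j
    ≡⟨ symPerm-symmetric σ i j ⟩
  symPerm σ i j ∎
  where open ≡-Reasoning

symPerm-nonneg : (σ : Permutation′ n) (i j : Fin n) → 0ℚ ≤ symPerm σ i j
symPerm-nonneg σ i j =
  ℚ.*-monoˡ-≤-nonNeg ½ (ℚ.+-mono-≤ (δ-nonneg (σ ⟨$⟩ʳ i) j) (δ-nonneg (σ ⟨$⟩ʳ j) i))

symPerm-inΩ : (σ : Permutation′ n) → CommutesWithOpposite σ → InΩth (symPerm σ)
symPerm-inΩ σ σ-opp =
  ( symPerm-nonneg σ
  , symPerm-rowSum σ
  , (λ j → trans (sumFin-cong (symPerm-symmetric σ j)) (symPerm-rowSum σ j)) )
  , symPerm-symmetric σ
  , symPerm-hankelSymmetric σ σ-opp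

module _ (σ : Permutation′ n) {S : Pred (Fin n) 0ℓ} (S? : Decidable S)
         (S-σ² : ∀ x → S x ⇔ S (σ ⟨$⟩ʳ (σ ⟨$⟩ʳ x))) where

  private
    forward : Fin n → Fin n
    forward x = if does (S? x) then σ ⟨$⟩ˡ x else σ ⟨$⟩ʳ x

    backward : Fin n → Fin n
    backward y = if does (S? (σ ⟨$⟩ʳ y)) then σ ⟨$⟩ʳ y else σ ⟨$⟩ˡ y

    forward-∈ : ∀ {x} → S x → forward x ≡ σ ⟨$⟩ˡ x
    forward-∈ {x} x∈S with S? x
    ... | yes _   = refl
    ... | no x∉S  = ⊥-elim (x∉S x∈S)

    forward-∉ : ∀ {x} → ¬ S x → forward x ≡ σ ⟨$⟩ʳ x
    forward-∉ {x} x∉S with S? x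
    ... | yes x∈S = ⊥-elim (x∉S x∈S)
    ... | no _    = refl

    backward-∈ : ∀ {y} → S (σ ⟨$⟩ʳ y) → backward y ≡ σ ⟨$⟩ʳ y
    backward-∈ {y} σy∈S with S? (σ ⟨$⟩ʳ y)
    ... | yes _   = refl
    ... | no σy∉S = ⊥-elim (σy∉S σy∈S)

    backward-∉ : ∀ {y} → ¬ S (σ ⟨$⟩ʳ y) → backward y ≡ σ ⟨$⟩ˡ y
    backward-∉ {y} σy∉S with S? (σ ⟨$⟩ʳ y)
    ... | yes σy∈S = ⊥-elim (σy∉S σy∈S)
    ... | no _     = refl

    backward-forward : ∀ x → backward (forward x) ≡ x
    backward-forward x with S? x
    ... | yes x∈S = trans (backward-∈ (subst S (sym (inverseʳ σ)) x∈S)) (inverseʳ σ)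
    ... | no x∉S  = trans (backward-∉ (x∉S ∘ Equivalence.from (S-σ² x))) (inverseˡ σ)

    forward-backward : ∀ y → forward (backward y) ≡ y
    forward-backward y with S? (σ ⟨$⟩ʳ y)
    ... | yes σy∈S = trans (forward-∈ σy∈S) (inverseˡ σ)
    ... | no σy∉S  = trans (forward-∉ σ⁻¹y∉S) (inverseʳ σ)
      where
      σ⁻¹y∉S : ¬ S (σ ⟨$⟩ˡ y)
      σ⁻¹y∉S σ⁻¹y∈S =
        σy∉S (subst (λ z → S (σ ⟨$⟩ʳ z)) (inverseʳ σ) (Equivalence.to (S-σ² _) σ⁻¹y∈S))

  reverseOn : Permutation′ n
  reverseOn = permutation forward backward forward-backward backward-forward

  reverseOn-∈ : ∀ {x} → S x → reverseOn ⟨$⟩ʳ x ≡ σ ⟨$⟩ˡ x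
  reverseOn-∈ = forward-∈

  reverseOn-∉ : ∀ {x} → ¬ S x → reverseOn ⟨$⟩ʳ x ≡ σ ⟨$⟩ʳ x
  reverseOn-∉ = forward-∉

  reverseOn⁻¹-∈ : ∀ {y} → S (σ ⟨$⟩ʳ y) → reverseOn ⟨$⟩ˡ y ≡ σ ⟨$⟩ʳ y
  reverseOn⁻¹-∈ = backward-∈

  reverseOn⁻¹-∉ : ∀ {y} → ¬ S (σ ⟨$⟩ʳ y) → reverseOn ⟨$⟩ˡ y ≡ σ ⟨$⟩ˡ y
  reverseOn⁻¹-∉ = backward-∉

  reverseOn-commutesWithOpposite : CommutesWithOpposite σ → (∀ x → S x → S (opposite x)) →
    CommutesWithOpposite reverseOn
  reverseOn-commutesWithOpposite σ-opp S-opp x with S? x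
  ... | yes x∈S =
    trans (reverseOn-∈ {opposite x} (S-opp x x∈S)) (inverse-commutesWithOpposite σ σ-opp x)
  ... | no x∉S  =
    trans (reverseOn-∉ {opposite x} (x∉S ∘ subst S (opposite-involutive x) ∘ S-opp _)) (σ-opp x)

Alternate : Permutation′ n → Pred (Fin n) 0ℓ → Pred (Fin n) 0ℓ → Set
Alternate σ S T = ∀ x → S x ⇔ T (σ ⟨$⟩ʳ x)

alternate⇒σ²-invariant : {σ : Permutation′ n} {S T : Pred (Fin n) 0ℓ} →
  Alternate σ S T → Alternate σ T S → ∀ x → S x ⇔ S (σ ⟨$⟩ʳ (σ ⟨$⟩ʳ x))
alternate⇒σ²-invariant {σ = σ} {S} {T} S⇄T T⇄S x = T⇄S (σ ⟨$⟩ʳ x) ⇔-∘ S⇄T x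

module AlternatingReversals {σ : Permutation′ n} {S T : Pred (Fin n) 0ℓ}
         (S? : Decidable S) (T? : Decidable T) (S⇄T : Alternate σ S T) (T⇄S : Alternate σ T S) where

  S-σ² : ∀ x → S x ⇔ S (σ ⟨$⟩ʳ (σ ⟨$⟩ʳ x))
  S-σ² = alternate⇒σ²-invariant {σ = σ} {S = S} {T} S⇄T T⇄S

  T-σ² : ∀ x → T x ⇔ T (σ ⟨$⟩ʳ (σ ⟨$⟩ʳ x))
  T-σ² = alternate⇒σ²-invariant {σ = σ} {S = T} {S} T⇄S S⇄T

  ρS ρT : Permutation′ n
  ρS = reverseOn σ S? S-σ²
  ρT = reverseOn σ T? T-σ²

  reverseOn-pair : ∀ i j →
    δ (ρS ⟨$⟩ʳ i) j + δ (ρT ⟨$⟩ˡ i) j ≡ δ (σ ⟨$⟩ʳ i) j + δ (σ ⟨$⟩ˡ i) j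
  reverseOn-pair i j with S? i
  ... | yes i∈S =
    trans (cong (λ z → δ (σ ⟨$⟩ˡ i) j + δ z j)
                (reverseOn⁻¹-∈ σ T? T-σ² (Equivalence.to (S⇄T i) i∈S)))
          (ℚ.+-comm (δ (σ ⟨$⟩ˡ i) j) (δ (σ ⟨$⟩ʳ i) j))
  ... | no i∉S  =
    cong (λ z → δ (σ ⟨$⟩ʳ i) j + δ z j)
         (reverseOn⁻¹-∉ σ T? T-σ² (i∉S ∘ Equivalence.from (S⇄T i)))

average-of-pairs : ∀ s x₁ x₂ x₃ x₄ → x₁ + x₄ ≡ s → x₃ + x₂ ≡ s →
  ½ * s ≡ ½ * (½ * (x₁ + x₂)) + (1ℚ - ½) * (½ * (x₃ + x₄))
average-of-pairs s x₁ x₂ x₃ x₄ x₁₄≡s x₃₂≡s = begin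
  ½ * s
    ≡⟨ solve 1 (λ s → con ½ :* s := con ½ :* (con ½ :* (s :+ s))) refl s ⟩
  ½ * (½ * (s + s))
    ≡⟨ cong₂ (λ u v → ½ * (½ * (u + v))) (sym x₁₄≡s) (sym x₃₂≡s) ⟩
  ½ * (½ * ((x₁ + x₄) + (x₃ + x₂)))
    ≡⟨ solve 4 (λ x₁ x₂ x₃ x₄ → con ½ :* (con ½ :* ((x₁ :+ x₄) :+ (x₃ :+ x₂)))
                  := con ½ :* (con ½ :* (x₁ :+ x₂)) :+ con ½ :* (con ½ :* (x₃ :+ x₄)))
               refl x₁ x₂ x₃ x₄ ⟩
  ½ * (½ * (x₁ + x₂)) + (1ℚ - ½) * (½ * (x₃ + x₄)) ∎
  where open ≡-Reasoning; open +-*-Solver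

module _ {σ : Permutation′ n} {S T : Pred (Fin n) 0ℓ} (S? : Decidable S) (T? : Decidable T)
         (S⇄T : Alternate σ S T) (T⇄S : Alternate σ T S) where

  open AlternatingReversals {σ = σ} S? T? S⇄T T⇄S
  private module Swapped = AlternatingReversals {σ = σ} T? S? T⇄S S⇄T

  symPerm-split : symPerm σ ≐ ((½ ⊙ symPerm ρS) ⊕ ((1ℚ - ½) ⊙ symPerm ρT))
  symPerm-split i j = begin
    symPerm σ i j
      ≡⟨ symPerm-entry σ i j ⟩
    ½ * (δ (σ ⟨$⟩ʳ i) j + δ (σ ⟨$⟩ˡ i) j)
      ≡⟨ average-of-pairs _ (δ (ρS ⟨$⟩ʳ i) j) (δ (ρS ⟨$⟩ˡ i) j) (δ (ρT ⟨$⟩ʳ i) j) (δ (ρT ⟨$⟩ˡ i) j)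
                          (reverseOn-pair i j) (Swapped.reverseOn-pair i j) ⟩
    ½ * (½ * (δ (ρS ⟨$⟩ʳ i) j + δ (ρS ⟨$⟩ˡ i) j))
      + (1ℚ - ½) * (½ * (δ (ρT ⟨$⟩ʳ i) j + δ (ρT ⟨$⟩ˡ i) j))
      ≡⟨ cong₂ (λ u v → ½ * u + (1ℚ - ½) * v) (symPerm-entry ρS i j) (symPerm-entry ρT i j) ⟨
    ½ * symPerm ρS i j + (1ℚ - ½) * symPerm ρT i j ∎
    where open ≡-Reasoning

  symPerm-reversals-differ : ∀ {i} → T i → ¬ S i → ¬ σ ⟨$⟩ʳ (σ ⟨$⟩ʳ i) ≡ i →
    ¬ symPerm ρS ≐ symPerm ρT
  symPerm-reversals-differ {i} i∈T i∉S σ²i≢i ρS≐ρT =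
    ℚ.1≢0 (trans (sym entry-ρS) (trans (ρS≐ρT i (σ ⟨$⟩ʳ i)) entry-ρT))
    where
    open ≡-Reasoning
    σi∈S : S (σ ⟨$⟩ʳ i)
    σi∈S = Equivalence.to (T⇄S i) i∈T
    σ⁻¹i≢σi : ¬ σ ⟨$⟩ˡ i ≡ σ ⟨$⟩ʳ i
    σ⁻¹i≢σi eq = σ²i≢i (trans (cong (σ ⟨$⟩ʳ_) (sym eq)) (inverseʳ σ))
    entry-ρS : symPerm ρS i (σ ⟨$⟩ʳ i) ≡ 1ℚ
    entry-ρS = begin
      symPerm ρS i (σ ⟨$⟩ʳ i)
        ≡⟨ symPerm-entry ρS i (σ ⟨$⟩ʳ i) ⟩
      ½ * (δ (ρS ⟨$⟩ʳ i) (σ ⟨$⟩ʳ i) + δ (ρS ⟨$⟩ˡ i) (σ ⟨$⟩ʳ i))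
        ≡⟨ cong₂ (λ u v → ½ * (δ u (σ ⟨$⟩ʳ i) + δ v (σ ⟨$⟩ʳ i)))
                 (reverseOn-∉ σ S? S-σ² i∉S) (reverseOn⁻¹-∈ σ S? S-σ² σi∈S) ⟩
      ½ * (δ (σ ⟨$⟩ʳ i) (σ ⟨$⟩ʳ i) + δ (σ ⟨$⟩ʳ i) (σ ⟨$⟩ʳ i))
        ≡⟨ cong (λ d → ½ * (d + d)) (δ-diag (σ ⟨$⟩ʳ i)) ⟩
      1ℚ ∎
    entry-ρT : symPerm ρT i (σ ⟨$⟩ʳ i) ≡ 0ℚ
    entry-ρT = begin
      symPerm ρT i (σ ⟨$⟩ʳ i)
        ≡⟨ symPerm-entry ρT i (σ ⟨$⟩ʳ i) ⟩
      ½ * (δ (ρT ⟨$⟩ʳ i) (σ ⟨$⟩ʳ i) + δ (ρT ⟨$⟩ˡ i) (σ ⟨$⟩ʳ i))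
        ≡⟨ cong₂ (λ u v → ½ * (δ u (σ ⟨$⟩ʳ i) + δ v (σ ⟨$⟩ʳ i)))
                 (reverseOn-∈ σ T? T-σ² i∈T)
                 (reverseOn⁻¹-∉ σ T? T-σ² (i∉S ∘ Equivalence.from (S⇄T i))) ⟩
      ½ * (δ (σ ⟨$⟩ˡ i) (σ ⟨$⟩ʳ i) + δ (σ ⟨$⟩ˡ i) (σ ⟨$⟩ʳ i))
        ≡⟨ cong (λ d → ½ * (d + d)) (δ-off σ⁻¹i≢σi) ⟩
      0ℚ ∎

suc-%-cong : ∀ a b d .{{_ : NonZero d}} → a % d ≡ b % d → suc a % d ≡ suc b % d
suc-%-cong a b d eq = begin
  suc a % d                 ≡⟨ %-distribˡ-+ 1 a d ⟩
  (1 % d ℕ.+ a % d) % d     ≡⟨ cong (λ r → (1 % d ℕ.+ r) % d) eq ⟩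
  (1 % d ℕ.+ b % d) % d     ≡⟨ %-distribˡ-+ 1 b d ⟨
  suc b % d                 ∎
  where open ≡-Reasoning

module CycleParity {m : ℕ} (σ : Permutation′ n) (c : Fin (suc m) → Fin n)
                   (cycle : IsCycleOf σ c) (2∣len : 2 ∣ suc m) where

  pos : ℕ → Fin (suc m)
  pos a = fromℕ< (m%n<n a (suc m))

  toℕ-pos : ∀ a → toℕ (pos a) ≡ a % suc m
  toℕ-pos a = toℕ-fromℕ< (m%n<n a (suc m))

  at : ℕ → Fin n
  at a = c (pos a)

  at-mod : ∀ a b → a % suc m ≡ b % suc m → at a ≡ at b
  at-mod a b eq = cong c (toℕ-injective (trans (toℕ-pos a) (trans eq (sym (toℕ-pos b)))))

  at-injective : ∀ a b → at a ≡ at b → a % suc m ≡ b % suc m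
  at-injective a b eq =
    trans (sym (toℕ-pos a)) (trans (cong toℕ (proj₁ cycle eq)) (toℕ-pos b))

  at-toℕ : ∀ s → at (toℕ s) ≡ c s
  at-toℕ s = cong c (toℕ-injective (trans (toℕ-pos (toℕ s)) (m<n⇒m%n≡m (toℕ<n s))))

  σ-at : ∀ a → σ ⟨$⟩ʳ at a ≡ at (suc a)
  σ-at a = trans (proj₂ cycle (pos a))
                 (at-mod (suc (toℕ (pos a))) (suc a) (suc-%-cong (toℕ (pos a)) a (suc m) pos-a≡a))
    where
    pos-a≡a : toℕ (pos a) % suc m ≡ a % suc m
    pos-a≡a = trans (cong (_% suc m) (toℕ-pos a)) (m%n%n≡m%n a (suc m))

  OfParity : ℕ → Pred (Fin n) 0ℓ
  OfParity p x = ∃[ s ] c s ≡ x × toℕ s % 2 ≡ p % 2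

  ofParity? : ∀ p → Decidable (OfParity p)
  ofParity? p x = any? (λ s → (c s Fin.≟ x) ×-dec (toℕ s % 2 ℕ.≟ p % 2))

  at-ofParity : ∀ a → OfParity a (at a)
  at-ofParity a = pos a , refl , trans (cong (_% 2) (toℕ-pos a)) (m∣n⇒o%n%m≡o%m 2 (suc m) a 2∣len)

  ofParity-resp : ∀ {p q x} → p % 2 ≡ q % 2 → OfParity p x → OfParity q x
  ofParity-resp p≡q (s , cs≡x , par) = s , cs≡x , trans par p≡q

  ofParity⇒at : ∀ {p x} → OfParity p x → ∃[ a ] at a ≡ x × a % 2 ≡ p % 2
  ofParity⇒at (s , cs≡x , par) = toℕ s , trans (at-toℕ s) cs≡x , par

  ofParity-unique : ∀ {p q x} → OfParity p x → OfParity q x → p % 2 ≡ q % 2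
  ofParity-unique (s , cs≡x , par) (t , ct≡x , par′) =
    trans (sym par) (trans (cong (λ u → toℕ u % 2) (proj₁ cycle (trans cs≡x (sym ct≡x)))) par′)

  ofParity-alternate : ∀ p → Alternate σ (OfParity p) (OfParity (suc p))
  ofParity-alternate p x = record
    { to        = to
    ; from      = from
    ; to-cong   = cong to
    ; from-cong = cong from
    }
    where
    to : OfParity p x → OfParity (suc p) (σ ⟨$⟩ʳ x)
    to x∈p with ofParity⇒at {p} x∈p
    ... | a , refl , par = subst (OfParity (suc p)) (sym (σ-at a))
                                 (ofParity-resp {suc a} {suc p} (suc-%-cong a p 2 par) (at-ofParity (suc a)))
    -- The predecessor of at b on the cycle is at (b + m).
    from : OfParity (suc p) (σ ⟨$⟩ʳ x) → OfParity p x
    from σx∈sp with ofParity⇒at {suc p} σx∈sp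
    ... | b , at-b≡σx , par =
      subst (OfParity p) at-b+m≡x
            (ofParity-resp {b ℕ.+ m} {p} (suc-%-cong (suc (b ℕ.+ m)) (suc p) 2 par′)
                           (at-ofParity (b ℕ.+ m)))
      where
      b+len≡b : suc (b ℕ.+ m) % suc m ≡ b % suc m
      b+len≡b = trans (cong (_% suc m) (sym (ℕ.+-suc b m))) ([m+n]%n≡m%n b (suc m))
      at-b+m≡x : at (b ℕ.+ m) ≡ x
      at-b+m≡x = ⟨$⟩ʳ-injective σ
        (trans (σ-at (b ℕ.+ m)) (trans (at-mod (suc (b ℕ.+ m)) b b+len≡b) at-b≡σx))
      par′ : suc (b ℕ.+ m) % 2 ≡ suc p % 2
      par′ = trans (cong (_% 2) (sym (ℕ.+-suc b m))) (trans (%-remove-+ʳ b 2∣len) par)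

  σ²-moves : 2 ℕ.< suc m → ¬ σ ⟨$⟩ʳ (σ ⟨$⟩ʳ at 0) ≡ at 0
  σ²-moves 2<len σ²at0≡at0 =
    ℕ.1+n≢0 (trans (sym (m<n⇒m%n≡m 2<len)) (at-injective 2 0 (trans (sym σ²-at-0) σ²at0≡at0)))
    where
    σ²-at-0 : σ ⟨$⟩ʳ (σ ⟨$⟩ʳ at 0) ≡ at 2
    σ²-at-0 = trans (cong (σ ⟨$⟩ʳ_) (σ-at 0)) (σ-at 1)

module CentrosymmetricCycle {m : ℕ} (σ : Permutation′ n) (σ-opp : CommutesWithOpposite σ)
         (c : Fin (suc m) → Fin n) (cycle : IsCycleOf σ c) (centro : IsCentrosymmetricCycle c)
         (4∣len : 4 ∣ suc m) where

  open CycleParity σ c cycle (∣-trans (divides 2 refl) 4∣len) public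

  shift : ℕ
  shift = toℕ (proj₁ (centro zero))

  opposite-at : ∀ a → opposite (at a) ≡ at (a ℕ.+ shift)
  opposite-at ℕ.zero  = trans (proj₂ (centro zero)) (sym (at-toℕ (proj₁ (centro zero))))
  opposite-at (suc a) = begin
    opposite (at (suc a))           ≡⟨ cong opposite (σ-at a) ⟨
    opposite (σ ⟨$⟩ʳ at a)          ≡⟨ σ-opp (at a) ⟨
    σ ⟨$⟩ʳ opposite (at a)          ≡⟨ cong (σ ⟨$⟩ʳ_) (opposite-at a) ⟩
    σ ⟨$⟩ʳ at (a ℕ.+ shift)         ≡⟨ σ-at (a ℕ.+ shift) ⟩
    at (suc a ℕ.+ shift)            ∎
    where open ≡-Reasoning

  -- opposite is an involution, so the length divides 2 · shift; this is where 4 ∣ length is used.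
  shift-even : 2 ∣ shift
  shift-even = *-cancelˡ-∣ 2 (∣-trans 4∣len (m%n≡0⇒n∣m (2 ℕ.* shift) (suc m) 2shift%len≡0))
    where
    at-2shift : at (2 ℕ.* shift) ≡ at 0
    at-2shift = begin
      at (2 ℕ.* shift)               ≡⟨ cong at (cong (shift ℕ.+_) (ℕ.+-identityʳ shift)) ⟩
      at (shift ℕ.+ shift)           ≡⟨ opposite-at shift ⟨
      opposite (at shift)            ≡⟨ cong opposite (opposite-at 0) ⟨
      opposite (opposite (at 0))     ≡⟨ opposite-involutive (at 0) ⟩
      at 0                           ∎
      where open ≡-Reasoning
    2shift%len≡0 : 2 ℕ.* shift % suc m ≡ 0
    2shift%len≡0 = at-injective (2 ℕ.* shift) 0 at-2shift

  ofParity-opposite : ∀ p x → OfParity p x → OfParity p (opposite x)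
  ofParity-opposite p x x∈p with ofParity⇒at {p} x∈p
  ... | a , refl , par = subst (OfParity p) (sym (opposite-at a))
                               (ofParity-resp {a ℕ.+ shift} {p} (trans (%-remove-+ʳ a shift-even) par)
                                              (at-ofParity (a ℕ.+ shift)))

lemma3p10 : (n : ℕ) → 2 ∣ n → (σ : Permutation′ n) →
    IsCentrosymmetric (permMatrix σ) →
    (m : ℕ) → (c : Fin (suc m) → Fin n) →
    IsCycleOf σ c → IsCentrosymmetricCycle c → 4 ∣ suc m →
    ¬ IsExtremePoint InΩth (½ ⊙ (permMatrix σ ⊕ transpose (permMatrix σ)))
lemma3p10 n _ σ centro m c cycle centro-cycle 4∣len (_ , extreme) =
  symPerm-reversals-differ {σ = σ} odd? even? odd⇄even even⇄odd
    (at-ofParity 0) (λ odd → ℕ.0≢1+n (ofParity-unique {0} {1} (at-ofParity 0) odd)) (σ²-moves 2<len)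
    (extreme (symPerm ρS) (symPerm ρT) ½
             (symPerm-inΩ ρS (reverseOn-commutesWithOpposite σ odd? S-σ² σ-opp (ofParity-opposite 1)))
             (symPerm-inΩ ρT (reverseOn-commutesWithOpposite σ even? T-σ² σ-opp (ofParity-opposite 0)))
             (ℚ.positive⁻¹ ½) (from-yes (½ ℚ.<? 1ℚ))
             (symPerm-split {σ = σ} odd? even? odd⇄even even⇄odd))
  where
  σ-opp : CommutesWithOpposite σ
  σ-opp = centrosymmetric⇒commutesWithOpposite σ centro
  open CentrosymmetricCycle σ σ-opp c cycle centro-cycle 4∣len
  odd? : Decidable (OfParity 1)
  odd? = ofParity? 1
  even? : Decidable (OfParity 0)
  even? = ofParity? 0
  odd⇄even : Alternate σ (OfParity 1) (OfParity 0)
  odd⇄even = ofParity-alternate 1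
  even⇄odd : Alternate σ (OfParity 0) (OfParity 1)
  even⇄odd = ofParity-alternate 0
  open AlternatingReversals {σ = σ} odd? even? odd⇄even even⇄odd
  2<len : 2 ℕ.< suc m
  2<len = ℕ.≤-trans (ℕ.n≤1+n 3) (∣⇒≤ 4∣len)
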